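{- For every integer $n\ge3$, $\gamma_{tr3}(P_3\square P_n)=\left\lceil\frac{8n}{3}\right\rceil+1$ if $n\equiv0\pmod 3$, and $\gamma_{tr3}(P_3\square P_n)=\left\lceil\frac{8n}{3}\right\rceil$ if $n\equiv1,2\pmod3$.
   Context: $P_m$ denotes the directed path with vertex set $\{0,1,\dots,m-1\}$ and arcs $(i,i+1)$ for $0\le i\le m-2$. The Cartesian product $D_1\square D_2$ has vertex set $V(D_1)\times V(D_2)$, with an arc from $(x_1,y_1)$ to $(x_2,y_2)$ iff either $(x_1,x_2)$ is an arc of $D_1$ and $y_1=y_2$, or $x_1=x_2$ and $(y_1,y_2)$ is an arc of $D_2$. For a digraph $D$ and positive integer $k$, a $k$RDF is a function $f:V(D)\to\mathcal{P}(\{1,\dots,k\})$ such that every $v$ with $f(v)=\emptyset$ satisfies $\bigcup_{u\in N^-(v)}f(u)=\{1,\dots,k\}$ ($N^-(v)$ the in-neighbors of $v$); its weight is $\sum_v|f(v)|$. For $D$ with no isolated vertex, a T$k$RDF is a $k$RDF $f$ such that the subdigraph induced by $\{v:f(v)\neq\emptyset\}$ has no isolated vertex (a vertex with no in- or out-neighbors in it); $\gamma_{trk}(D)$ is the minimum weight of a T$k$RDF. -}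

module Defs where

import Data.Nat as ℕ
open import Data.Nat using (ℕ; _+_; _*_; _≤_; _/_; _%_)
open import Data.Fin using (Fin; toℕ; remQuot; zero; suc)
open import Data.Fin.Subset using (Subset; ⊥; _∈_; ∣_∣)
open import Data.Product using (Σ; ∃; _×_; _,_; proj₁; proj₂)
open import Data.Sum using (_⊎_)
open import Relation.Binary.PropositionalEquality using (_≡_; _≢_)

record Digraph : Set₁ where
  field
    N   : ℕ
    Arc : Fin N → Fin N → Set
open Digraph public

P : ℕ → Digraph
P m = record { N = m ; Arc = λ i j → toℕ j ≡ ℕ.suc (toℕ i) }

_□_ : Digraph → Digraph → Digraph
D₁ □ D₂ = record
  { N   = N D₁ * N D₂
  ; Arc = λ x y →
      let x₁ = proj₁ (remQuot {N D₁} (N D₂) x) ; x₂ = proj₂ (remQuot {N D₁} (N D₂) x)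
          y₁ = proj₁ (remQuot {N D₁} (N D₂) y) ; y₂ = proj₂ (remQuot {N D₁} (N D₂) y)
      in (Arc D₁ x₁ y₁ × x₂ ≡ y₂) ⊎ (x₁ ≡ y₁ × Arc D₂ x₂ y₂)
  }

sumFin : (n : ℕ) → (Fin n → ℕ) → ℕ
sumFin ℕ.zero    g = 0
sumFin (ℕ.suc n) g = g zero + sumFin n (λ i → g (suc i))


NoIsolated : Digraph → Set
NoIsolated D = ∀ v → ∃ λ u → Arc D u v ⊎ Arc D v u

IsKRDF : (D : Digraph) (k : ℕ) → (Fin (N D) → Subset k) → Set
IsKRDF D k f = ∀ v → f v ≡ ⊥ → ∀ (i : Fin k) → ∃ λ u → Arc D u v × i ∈ f u

IsTKRDF : (D : Digraph) (k : ℕ) → (Fin (N D) → Subset k) → Set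
IsTKRDF D k f = IsKRDF D k f ×
  (∀ v → f v ≢ ⊥ → ∃ λ u → f u ≢ ⊥ × (Arc D u v ⊎ Arc D v u))

weight : (D : Digraph) {k : ℕ} → (Fin (N D) → Subset k) → ℕ
weight D f = sumFin (N D) (λ v → ∣ f v ∣)

IsTotalKRomanDomNumber : (D : Digraph) (k m : ℕ) → Set
IsTotalKRomanDomNumber D k m =
  (Σ (Fin (N D) → Subset k) λ f → IsTKRDF D k f × weight D f ≡ m) ×
  (∀ f → IsTKRDF D k f → m ≤ weight D f)

ceil3 : ℕ → ℕ
ceil3 a = (a + 2) / 3

-- Read a total 3-Roman dominating function f of P₃ □ Pₙ column by column.  Recording for
-- each column the sizes of its three labels, and for each labelled cell whether it still
-- lacks a labelled neighbour above, to the left or below (so that the cell to its right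
-- must be labelled), turns the defining conditions into constraints between consecutive
-- columns over a finite set of states.  A potential Φ on these states satisfies
-- 8 + Φ(s′) ≤ Φ(s) + 3·|new column| along every admissible step, 8 + Φ(s₁) ≤ 3·|first
-- column| and Φ ≥ 1 on final states, as checked by evaluating all cases.  Telescoping
-- gives 8n < 3·w(f), i.e. w(f) ≥ ⌊8n/3⌋ + 1.  The 3-periodic labelling whose columns are
-- ({1},{1},{1}), ({1},{2,3},∅), ({1},∅,{1}) has weight 8 per period and, after labelling
-- the middle cell of a final column of the third kind, weight exactly ⌊8n/3⌋ + 1.  Finally
-- ⌊8n/3⌋ + 1 is ⌈8n/3⌉ + 1 when 3 ∣ n and ⌈8n/3⌉ otherwise.

module Submission where

open import Defs
open import Data.Bool using (Bool; true; false; T; _∧_; _∨_; not)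
open import Data.Bool.Properties using (T-∧; T-∨; T-≡)
open import Data.Nat using (ℕ; zero; suc; _+_; _*_; _≤_; _<_; _≤ᵇ_; _≡ᵇ_; _<?_; _/_; _%_; s≤s; z≤n; NonZero)
open import Data.Nat.Properties
open import Data.Nat.DivMod using (m*n/n≡m; /-monoˡ-≤; +-distrib-/-∣ʳ; n/n≡1; m<n*o⇒m/o<n; m≡m%n+[m/n]*n; %-distribˡ-*)
open import Data.Nat.Divisibility using (divides-refl; ∣-refl)
open import Data.Fin using (Fin; toℕ; fromℕ; fromℕ<; inject₁; combine; remQuot; _↑ˡ_; _↑ʳ_)
import Data.Fin as Fin
open import Data.Fin.Patterns using (0F; 1F; 2F)
open import Data.Fin.Properties using (toℕ-injective; toℕ-fromℕ<; fromℕ<-toℕ; toℕ<n; toℕ-inject₁; toℕ-fromℕ; remQuot-combine; combine-remQuot)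
open import Data.Fin.Subset using (Subset; _∈_; _∪_; ∁; ⁅_⁆; ∣_∣; ⊤; outside; inside) renaming (⊥ to ∅)
open import Data.Fin.Subset.Properties using (∉⊥; ∣⊥∣≡0; ∣⊤∣≡n; ∣p∣≤∣x∷p∣; p⊆q⇒∣p∣≤∣q∣; x∈p∪q⁺)
open import Data.Vec using ([]; _∷_; here; there)
open import Data.Product using (_×_; _,_; proj₁; proj₂; ∃; ∃₂; uncurry)
open import Data.Sum using (_⊎_; inj₁; inj₂)
import Data.Sum as Sum
open import Function using (_∘_)
open import Function.Bundles using (Equivalence)
open import Relation.Nullary using (¬_; yes; no; contradiction)
open import Relation.Binary.PropositionalEquality
open import Algebra.Properties.CommutativeMonoid.Sum +-0-commutativeMonoid using (sum; sum-cong-≗; sum-init-last; ∑-comm)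

sumTo : ℕ → (ℕ → ℕ) → ℕ
sumTo zero    h = 0
sumTo (suc k) h = sumTo k h + h k

sumFin≡sum : ∀ n (h : Fin n → ℕ) → sumFin n h ≡ sum h
sumFin≡sum zero    h = refl
sumFin≡sum (suc n) h = cong (h Fin.zero +_) (sumFin≡sum n (h ∘ Fin.suc))

sum-↑ : ∀ m {n} (h : Fin (m + n) → ℕ) → sum h ≡ sum (h ∘ (_↑ˡ n)) + sum (h ∘ (m ↑ʳ_))
sum-↑ zero    h = refl
sum-↑ (suc m) h = trans (cong (h _ +_) (sum-↑ m (h ∘ Fin.suc))) (sym (+-assoc (h _) _ _))

sum-combine : ∀ m n (h : Fin (m * n) → ℕ) → sum h ≡ sum {m} (λ r → sum {n} (λ J → h (combine r J)))
sum-combine zero    n h = refl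
sum-combine (suc m) n h =
  trans (sum-↑ n h) (cong (sum {n} (h ∘ (_↑ˡ m * n)) +_) (sum-combine m n (h ∘ (n ↑ʳ_))))

sum-mono-≤ : ∀ {n} {h h′ : Fin n → ℕ} → (∀ i → h i ≤ h′ i) → sum h ≤ sum h′
sum-mono-≤ {zero}  _   = ≤-refl
sum-mono-≤ {suc n} h≤h′ = +-mono-≤ (h≤h′ _) (sum-mono-≤ (h≤h′ ∘ Fin.suc))

sum-toℕ : ∀ n (h : ℕ → ℕ) → sum {n} (h ∘ toℕ) ≡ sumTo n h
sum-toℕ zero    h = refl
sum-toℕ (suc n) h = begin
  sum {suc n} (h ∘ toℕ)                           ≡⟨ sum-init-last (h ∘ toℕ) ⟩
  sum {n} (h ∘ toℕ ∘ inject₁) + h (toℕ (fromℕ n)) ≡⟨ cong₂ _+_ (sum-cong-≗ {n} (cong h ∘ toℕ-inject₁))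
                                                                (cong h (toℕ-fromℕ n)) ⟩
  sum {n} (h ∘ toℕ) + h n                         ≡⟨ cong (_+ h n) (sum-toℕ n h) ⟩
  sumTo n h + h n                                 ∎
  where open ≡-Reasoning

sumTo-cong< : ∀ k {h h′ : ℕ → ℕ} → (∀ j → j < k → h j ≡ h′ j) → sumTo k h ≡ sumTo k h′
sumTo-cong< zero    _  = refl
sumTo-cong< (suc k) h≡h′ =
  cong₂ _+_ (sumTo-cong< k (λ j j<k → h≡h′ j (m<n⇒m<1+n j<k))) (h≡h′ k (n<1+n k))

<⇒≡ᵇ-false : ∀ {i j} → i < j → (i ≡ᵇ j) ≡ false
<⇒≡ᵇ-false {i} {j} i<j with i ≡ᵇ j in i≡ᵇj
... | false = refl
... | true  = contradiction (≡ᵇ⇒≡ i j (Equivalence.from T-≡ i≡ᵇj)) (<⇒≢ i<j)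

≡ᵇ-false⇒≢ : ∀ {i j} → (i ≡ᵇ j) ≡ false → i ≢ j
≡ᵇ-false⇒≢ {i} i≢ᵇi refl = subst T i≢ᵇi (≡⇒≡ᵇ i i refl)

≤suc[/] : ∀ {a w} d .{{_ : NonZero d}} → d * w ≤ a + d → w ≤ suc (a / d)
≤suc[/] {a} {w} d dw≤a+d = begin
  w              ≡⟨ m*n/n≡m w d ⟨
  w * d / d      ≡⟨ cong (_/ d) (*-comm w d) ⟩
  d * w / d      ≤⟨ /-monoˡ-≤ d dw≤a+d ⟩
  (a + d) / d    ≡⟨ +-distrib-/-∣ʳ a ∣-refl ⟩
  a / d + d / d  ≡⟨ cong (a / d +_) (n/n≡1 d) ⟩
  a / d + 1      ≡⟨ +-comm (a / d) 1 ⟩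
  suc (a / d)    ∎
  where open ≤-Reasoning

weight-□ : ∀ D₁ D₂ {k} (f : Fin (N (D₁ □ D₂)) → Subset k) →
           weight (D₁ □ D₂) f ≡ sum {N D₂} (λ J → sum {N D₁} (λ r → ∣ f (combine r J) ∣))
weight-□ D₁ D₂ f = begin
  weight (D₁ □ D₂) f
    ≡⟨ sumFin≡sum _ (λ v → ∣ f v ∣) ⟩
  sum (λ v → ∣ f v ∣)
    ≡⟨ sum-combine (N D₁) (N D₂) (λ v → ∣ f v ∣) ⟩
  sum {N D₁} (λ r → sum {N D₂} (λ J → ∣ f (combine r J) ∣))
    ≡⟨ ∑-comm {N D₁} {N D₂} (λ r J → ∣ f (combine r J) ∣) ⟩
  sum {N D₂} (λ J → sum {N D₁} (λ r → ∣ f (combine r J) ∣))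
    ∎
  where open ≡-Reasoning

∣p∣≡0⇒p≡⊥ : ∀ {k} (p : Subset k) → ∣ p ∣ ≡ 0 → p ≡ ∅
∣p∣≡0⇒p≡⊥ []            _     = refl
∣p∣≡0⇒p≡⊥ (outside ∷ p) ∣p∣≡0 = cong (outside ∷_) (∣p∣≡0⇒p≡⊥ p ∣p∣≡0)

∣p∪q∣≤∣p∣+∣q∣ : ∀ {k} (p q : Subset k) → ∣ p ∪ q ∣ ≤ ∣ p ∣ + ∣ q ∣
∣p∪q∣≤∣p∣+∣q∣ []            []            = z≤n
∣p∪q∣≤∣p∣+∣q∣ (inside  ∷ p) (y       ∷ q) =
  s≤s (≤-trans (∣p∪q∣≤∣p∣+∣q∣ p q) (+-monoʳ-≤ ∣ p ∣ (∣p∣≤∣x∷p∣ y q)))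
∣p∪q∣≤∣p∣+∣q∣ (outside ∷ p) (outside ∷ q) = ∣p∪q∣≤∣p∣+∣q∣ p q
∣p∪q∣≤∣p∣+∣q∣ (outside ∷ p) (inside  ∷ q) =
  subst (∣ p ∪ q ∣ <_) (sym (+-suc ∣ p ∣ ∣ q ∣)) (s≤s (∣p∪q∣≤∣p∣+∣q∣ p q))

covering-size : ∀ {k} (p q : Subset k) → (∀ c → c ∈ p ⊎ c ∈ q) → k ≤ ∣ p ∣ + ∣ q ∣
covering-size {k} p q covers = begin
  k             ≡⟨ ∣⊤∣≡n k ⟨
  ∣ ⊤ {k} ∣     ≤⟨ p⊆q⇒∣p∣≤∣q∣ {p = ⊤} {p ∪ q} (λ {c} _ → x∈p∪q⁺ (covers c)) ⟩
  ∣ p ∪ q ∣     ≤⟨ ∣p∪q∣≤∣p∣+∣q∣ p q ⟩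
  ∣ p ∣ + ∣ q ∣ ∎
  where open ≤-Reasoning

Grid : ℕ → ℕ → ℕ → Set
Grid m n k = Fin m → Fin n → Subset k

cellsOf : ∀ {m n k} → (Fin (m * n) → Subset k) → Grid m n k
cellsOf f r J = f (combine r J)

fromCells : ∀ {m n k} → Grid m n k → Fin (m * n) → Subset k
fromCells {m} {n} g v = uncurry g (remQuot {m} n v)

-- Arc (P m □ P n) u v unfolds to GridArc (remQuot n u) (remQuot n v).
GridArc : ∀ {m n} → Fin m × Fin n → Fin m × Fin n → Set
GridArc (a , b) (r , J) = (toℕ r ≡ suc (toℕ a) × b ≡ J) ⊎ (a ≡ r × toℕ J ≡ suc (toℕ b))

-- The grid shifted by one in both directions and framed by empty cells, so that every cell
-- has an up, left, down and right neighbour (empty beyond the border).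
pad : ∀ {m n k} → Grid m n k → ℕ → ℕ → Subset k
pad {m} {n} g (suc i) (suc j) with i <? m | j <? n
... | yes i<m | yes j<n = g (fromℕ< i<m) (fromℕ< j<n)
... | _       | _       = ∅
pad g _ _ = ∅

module _ {m n k} (g : Grid m n k) where

  pad-cell : ∀ r J → pad g (suc (toℕ r)) (suc (toℕ J)) ≡ g r J
  pad-cell r J with toℕ r <? m | toℕ J <? n
  ... | yes r<m | yes J<n = cong₂ g (fromℕ<-toℕ r r<m) (fromℕ<-toℕ J J<n)
  ... | no r≮m  | _       = contradiction (toℕ<n r) r≮m
  ... | yes _   | no J≮n  = contradiction (toℕ<n J) J≮n

  pad-beyond : ∀ i → pad g i (suc n) ≡ ∅
  pad-beyond zero = refl
  pad-beyond (suc i) with i <? m | n <? n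
  ... | _     | yes n<n = contradiction n<n (n≮n n)
  ... | yes _ | no _    = refl
  ... | no _  | no _    = refl

  pad-support : {Q : Subset k → Set} → ¬ Q ∅ → ∀ i j → Q (pad g i j) →
                ∃₂ λ r J → suc (toℕ r) ≡ i × suc (toℕ J) ≡ j × Q (g r J)
  pad-support ¬Q∅ (suc i) (suc j) Q[pad] with i <? m | j <? n
  ... | yes i<m | yes j<n =
    fromℕ< i<m , fromℕ< j<n , cong suc (toℕ-fromℕ< i<m) , cong suc (toℕ-fromℕ< j<n) , Q[pad]
  ... | yes _   | no _    = contradiction Q[pad] ¬Q∅
  ... | no _    | _       = contradiction Q[pad] ¬Q∅
  pad-support ¬Q∅ zero    j       Q[pad] = contradiction Q[pad] ¬Q∅
  pad-support ¬Q∅ (suc i) zero    Q[pad] = contradiction Q[pad] ¬Q∅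

  up left down right : Fin m → Fin n → Subset k
  up    r J = pad g (toℕ r) (suc (toℕ J))
  left  r J = pad g (suc (toℕ r)) (toℕ J)
  down  r J = pad g (suc (suc (toℕ r))) (suc (toℕ J))
  right r J = pad g (suc (toℕ r)) (suc (suc (toℕ J)))

  in-neighbour : ∀ {a b r J} → GridArc (a , b) (r , J) → g a b ≡ up r J ⊎ g a b ≡ left r J
  in-neighbour {a} {b} (inj₁ (r≡1+a , refl)) =
    inj₁ (trans (sym (pad-cell a b)) (cong (λ i → pad g i (suc (toℕ b))) (sym r≡1+a)))
  in-neighbour {a} {b} (inj₂ (refl , J≡1+b)) =
    inj₂ (trans (sym (pad-cell a b)) (cong (pad g (suc (toℕ a))) (sym J≡1+b)))

  out-neighbour : ∀ {r J a b} → GridArc (r , J) (a , b) → g a b ≡ down r J ⊎ g a b ≡ right r J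
  out-neighbour {a = a} {b} (inj₁ (a≡1+r , refl)) =
    inj₁ (trans (sym (pad-cell a b)) (cong (λ i → pad g (suc i) (suc (toℕ b))) a≡1+r))
  out-neighbour {a = a} {b} (inj₂ (refl , b≡1+J)) =
    inj₂ (trans (sym (pad-cell a b)) (cong (λ j → pad g (suc (toℕ a)) (suc j)) b≡1+J))

  in-support : {Q : Subset k → Set} → ¬ Q ∅ → ∀ {r J} → Q (up r J) ⊎ Q (left r J) →
               ∃₂ λ a b → GridArc (a , b) (r , J) × Q (g a b)
  in-support {Q} ¬Q∅ {r} {J} (inj₁ Q[up]) with pad-support {Q} ¬Q∅ (toℕ r) (suc (toℕ J)) Q[up]
  ... | a , b , 1+a≡r , 1+b≡1+J , Qab =
    a , b , inj₁ (sym 1+a≡r , toℕ-injective (suc-injective 1+b≡1+J)) , Qab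
  in-support {Q} ¬Q∅ {r} {J} (inj₂ Q[left]) with pad-support {Q} ¬Q∅ (suc (toℕ r)) (toℕ J) Q[left]
  ... | a , b , 1+a≡1+r , 1+b≡J , Qab =
    a , b , inj₂ (toℕ-injective (suc-injective 1+a≡1+r) , sym 1+b≡J) , Qab

  out-support : {Q : Subset k → Set} → ¬ Q ∅ → ∀ {r J} → Q (down r J) ⊎ Q (right r J) →
                ∃₂ λ a b → GridArc (r , J) (a , b) × Q (g a b)
  out-support {Q} ¬Q∅ {r} {J} (inj₁ Q[down]) with pad-support {Q} ¬Q∅ (suc (suc (toℕ r))) (suc (toℕ J)) Q[down]
  ... | a , b , 1+a≡2+r , 1+b≡1+J , Qab =
    a , b , inj₁ (suc-injective 1+a≡2+r , toℕ-injective (suc-injective (sym 1+b≡1+J))) , Qab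
  out-support {Q} ¬Q∅ {r} {J} (inj₂ Q[right]) with pad-support {Q} ¬Q∅ (suc (toℕ r)) (suc (suc (toℕ J))) Q[right]
  ... | a , b , 1+a≡1+r , 1+b≡2+J , Qab =
    a , b , inj₂ (toℕ-injective (suc-injective (sym 1+a≡1+r)) , suc-injective 1+b≡2+J) , Qab

module _ {m n k} (g : Grid m (suc n) k) where

  left-suc : ∀ r b → left g r (Fin.suc b) ≡ g r (inject₁ b)
  left-suc r b = trans (cong (λ j → pad g (suc (toℕ r)) (suc j)) (sym (toℕ-inject₁ b))) (pad-cell g r (inject₁ b))

module _ {m n k} (g : Grid m n k) where

  right-next : ∀ r J (J+1<n : suc (toℕ J) < n) → right g r J ≡ g r (fromℕ< J+1<n)
  right-next r J J+1<n =
    trans (cong (λ j → pad g (suc (toℕ r)) (suc j)) (sym (toℕ-fromℕ< J+1<n))) (pad-cell g r (fromℕ< J+1<n))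

LocallyRoman : ∀ {m n k} → Grid m n k → Set
LocallyRoman g = ∀ r J → g r J ≡ ∅ → ∀ c → c ∈ up g r J ⊎ c ∈ left g r J

LocallyTotal : ∀ {m n k} → Grid m n k → Set
LocallyTotal g = ∀ r J → g r J ≢ ∅ →
  (up g r J ≢ ∅ ⊎ left g r J ≢ ∅) ⊎ (down g r J ≢ ∅ ⊎ right g r J ≢ ∅)

arc-into : ∀ {m n u} r J → Arc (P m □ P n) u (combine r J) → GridArc (remQuot {m} n u) (r , J)
arc-into {m} {n} {u} r J = subst (GridArc (remQuot {m} n u)) (remQuot-combine r J)

arc-from : ∀ {m n u} r J → Arc (P m □ P n) (combine r J) u → GridArc (r , J) (remQuot {m} n u)
arc-from {m} {n} {u} r J = subst (λ x → GridArc x (remQuot {m} n u)) (remQuot-combine r J)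

arc-to-combine : ∀ {m n v} a b → GridArc (a , b) (remQuot {m} n v) → Arc (P m □ P n) (combine a b) v
arc-to-combine {m} {n} {v} a b = subst (λ x → GridArc x (remQuot {m} n v)) (sym (remQuot-combine a b))

arc-from-combine : ∀ {m n v} a b → GridArc (remQuot {m} n v) (a , b) → Arc (P m □ P n) v (combine a b)
arc-from-combine {m} {n} {v} a b = subst (GridArc (remQuot {m} n v)) (sym (remQuot-combine a b))

cellsOf-remQuot : ∀ {m n k} (f : Fin (m * n) → Subset k) u → f u ≡ uncurry (cellsOf f) (remQuot {m} n u)
cellsOf-remQuot {m} {n} f u = cong f (sym (combine-remQuot {m} n u))

fromCells-combine : ∀ {m n k} (g : Grid m n k) a b → fromCells g (combine a b) ≡ g a b
fromCells-combine g a b = cong (uncurry g) (remQuot-combine a b)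

IsTKRDF⇒local : ∀ {m n k} {f : Fin (m * n) → Subset k} → IsTKRDF (P m □ P n) k f →
                LocallyRoman (cellsOf f) × LocallyTotal (cellsOf f)
IsTKRDF⇒local {m} {n} {k} {f} (roman , total) = locally-roman , locally-total
  where
  g : Grid m n k
  g = cellsOf f

  transport : ∀ {Q : Subset k → Set} u {S} → Q (f u) → uncurry g (remQuot {m} n u) ≡ S → Q S
  transport {Q} u Qfu refl = subst Q (cellsOf-remQuot {m} {n} f u) Qfu

  locally-roman : LocallyRoman g
  locally-roman r J gJ≡∅ c with roman (combine r J) gJ≡∅ c
  ... | u , arc , c∈fu =
    Sum.map (transport {c ∈_} u c∈fu) (transport {c ∈_} u c∈fu) (in-neighbour g (arc-into r J arc))

  locally-total : LocallyTotal g
  locally-total r J gJ≢∅ with total (combine r J) gJ≢∅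
  ... | u , fu≢∅ , inj₁ arc =
    inj₁ (Sum.map (transport {_≢ ∅} u fu≢∅) (transport {_≢ ∅} u fu≢∅) (in-neighbour g (arc-into r J arc)))
  ... | u , fu≢∅ , inj₂ arc =
    inj₂ (Sum.map (transport {_≢ ∅} u fu≢∅) (transport {_≢ ∅} u fu≢∅) (out-neighbour g (arc-from r J arc)))

local⇒IsTKRDF : ∀ {m n k} {g : Grid m n k} → LocallyRoman g → LocallyTotal g →
                IsTKRDF (P m □ P n) k (fromCells g)
local⇒IsTKRDF {m} {n} {k} {g} roman total = krdf , tkrdf
  where
  row : Fin (m * n) → Fin m
  row v = proj₁ (remQuot {m} n v)

  column : Fin (m * n) → Fin n
  column v = proj₂ (remQuot {m} n v)

  nonempty : ∀ {a b} → g a b ≢ ∅ → fromCells g (combine a b) ≢ ∅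
  nonempty {a} {b} = subst (_≢ ∅) (sym (fromCells-combine g a b))

  krdf : IsKRDF (P m □ P n) k (fromCells g)
  krdf v gv≡∅ c with in-support g {c ∈_} ∉⊥ (roman (row v) (column v) gv≡∅ c)
  ... | a , b , arc , c∈gab =
    combine a b , arc-to-combine a b arc , subst (c ∈_) (sym (fromCells-combine g a b)) c∈gab

  tkrdf : ∀ v → fromCells g v ≢ ∅ →
          ∃ λ u → fromCells g u ≢ ∅ × (Arc (P m □ P n) u v ⊎ Arc (P m □ P n) v u)
  tkrdf v gv≢∅ with total (row v) (column v) gv≢∅
  ... | inj₁ labelled-in with in-support g {_≢ ∅} (λ ∅≢∅ → ∅≢∅ refl) labelled-in
  ...   | a , b , arc , gab≢∅ = combine a b , nonempty gab≢∅ , inj₁ (arc-to-combine a b arc)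
  tkrdf v gv≢∅ | inj₂ labelled-out with out-support g {_≢ ∅} (λ ∅≢∅ → ∅≢∅ refl) labelled-out
  ...   | a , b , arc , gab≢∅ = combine a b , nonempty gab≢∅ , inj₂ (arc-from-combine a b arc)

T-∧ˡ : ∀ {a b} → T (a ∧ b) → T a
T-∧ˡ = proj₁ ∘ Equivalence.to T-∧

T-∧ʳ : ∀ {a b} → T (a ∧ b) → T b
T-∧ʳ = proj₂ ∘ Equivalence.to T-∧

T-∧-intro : ∀ {a b} → T a → T b → T (a ∧ b)
T-∧-intro ta tb = Equivalence.from T-∧ (ta , tb)

infixr 4 _⇒ᵇ_

_⇒ᵇ_ : Bool → Bool → Bool
a ⇒ᵇ b = not a ∨ b

T-⇒ᵇ : ∀ {a b} → T (a ⇒ᵇ b) → T a → T b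
T-⇒ᵇ {true} h _ = h

isolated-resolved : ∀ s u l d x → (T u ⊎ T l) ⊎ (T d ⊎ T x) → T (s ∧ not (u ∨ l ∨ d) ⇒ᵇ x)
isolated-resolved false _     _     _     _     _ = _
isolated-resolved true  true  _     _     _     _ = _
isolated-resolved true  false true  _     _     _ = _
isolated-resolved true  false false true  _     _ = _
isolated-resolved true  false false false true  _ = _
isolated-resolved true  false false false false (inj₁ (inj₁ ()))
isolated-resolved true  false false false false (inj₁ (inj₂ ()))
isolated-resolved true  false false false false (inj₂ (inj₁ ()))
isolated-resolved true  false false false false (inj₂ (inj₂ ()))

record Exhaustible (A : Set) : Set where
  field
    every       : (A → Bool) → Bool
    every-sound : ∀ p → T (every p) → ∀ x → T (p x)

open Exhaustible {{...}}

instance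
  Bool-exhaustible : Exhaustible Bool
  Bool-exhaustible = record
    { every       = λ p → p true ∧ p false
    ; every-sound = λ { p h true → T-∧ˡ h ; p h false → T-∧ʳ {p true} h }
    }

  ×-exhaustible : ∀ {A B : Set} → {{Exhaustible A}} → {{Exhaustible B}} → Exhaustible (A × B)
  ×-exhaustible = record
    { every       = λ p → every λ a → every λ b → p (a , b)
    ; every-sound = λ p h (a , b) → every-sound _ (every-sound _ h a) b
    }

-- The implicit argument is ⊤, solved automatically, exactly when every p evaluates to true.
by-evaluation : ∀ {A : Set} {{_ : Exhaustible A}} (p : A → Bool) → {T (every p)} → ∀ x → T (p x)
by-evaluation p {h} = every-sound p h

data Card : Set where
  c0 c1 c2 c3 : Card

instance
  Card-exhaustible : Exhaustible Card
  Card-exhaustible = record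
    { every       = λ p → p c0 ∧ p c1 ∧ p c2 ∧ p c3
    ; every-sound = sound
    }
    where
    sound : ∀ p → T (p c0 ∧ p c1 ∧ p c2 ∧ p c3) → ∀ x → T (p x)
    sound p h c0 = T-∧ˡ h
    sound p h c1 = T-∧ˡ (T-∧ʳ {p c0} h)
    sound p h c2 = T-∧ˡ (T-∧ʳ {p c1} (T-∧ʳ {p c0} h))
    sound p h c3 = T-∧ʳ {p c2} (T-∧ʳ {p c1} (T-∧ʳ {p c0} h))

fromCard : Card → ℕ
fromCard c0 = 0
fromCard c1 = 1
fromCard c2 = 2
fromCard c3 = 3

occupied : Card → Bool
occupied c0 = false
occupied _  = true

toCard : ℕ → Card
toCard 0 = c0
toCard 1 = c1
toCard 2 = c2
toCard (suc (suc (suc _))) = c3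

fromCard-toCard≤ : ∀ a → fromCard (toCard a) ≤ a
fromCard-toCard≤ 0 = z≤n
fromCard-toCard≤ 1 = ≤-refl
fromCard-toCard≤ 2 = ≤-refl
fromCard-toCard≤ (suc (suc (suc a))) = s≤s (s≤s (s≤s z≤n))

fromCard-toCard-+ : ∀ a b → 3 ≤ a + b → 3 ≤ fromCard (toCard a) + fromCard (toCard b)
fromCard-toCard-+ (suc (suc (suc _))) _ _ = m≤m+n 3 _
fromCard-toCard-+ a (suc (suc (suc _))) _ = m≤n+m 3 (fromCard (toCard a))
fromCard-toCard-+ 1 2 _ = ≤-refl
fromCard-toCard-+ 2 1 _ = ≤-refl
fromCard-toCard-+ 2 2 _ = n≤1+n 3
fromCard-toCard-+ 0 0 ()
fromCard-toCard-+ 0 1 (s≤s ())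
fromCard-toCard-+ 0 2 (s≤s (s≤s ()))
fromCard-toCard-+ 1 0 (s≤s ())
fromCard-toCard-+ 1 1 (s≤s (s≤s ()))
fromCard-toCard-+ 2 0 (s≤s (s≤s ()))

occupied-toCard-suc : ∀ a → T (occupied (toCard (suc a)))
occupied-toCard-suc 0 = _
occupied-toCard-suc 1 = _
occupied-toCard-suc (suc (suc _)) = _

occupied-toCard : ∀ {k} (p : Subset k) → p ≢ ∅ → T (occupied (toCard ∣ p ∣))
occupied-toCard p p≢∅ with ∣ p ∣ in ∣p∣≡
... | zero  = contradiction (∣p∣≡0⇒p≡⊥ p ∣p∣≡) p≢∅
... | suc a = occupied-toCard-suc a

Column : Set
Column = Card × Card × Card

-- The flags mark the cells of the column that are labelled but have no labelled neighbour
-- above, to the left or below, so that the cell to their right must be labelled.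
State : Set
State = Column × Bool × Bool × Bool

emptyColumn : Column
emptyColumn = c0 , c0 , c0

columnWeight : Column → ℕ
columnWeight (a , b , c) = fromCard a + (fromCard b + fromCard c)

dominated : Card → Card → Card → Bool
dominated self up left = occupied self ∨ (3 ≤ᵇ fromCard up + fromCard left)

romanStep : Column → Column → Bool
romanStep (p₀ , p₁ , p₂) (c₀ , c₁ , c₂) =
  dominated c₀ c0 p₀ ∧ dominated c₁ c₀ p₁ ∧ dominated c₂ c₁ p₂

isolated : Card → Card → Card → Card → Bool
isolated self up left down = occupied self ∧ not (occupied up ∨ occupied left ∨ occupied down)

advance : Column → Column → State
advance (p₀ , p₁ , p₂) c@(c₀ , c₁ , c₂) =
  c , isolated c₀ c0 p₀ c₁ , isolated c₁ c₀ p₁ c₂ , isolated c₂ c₁ p₂ c0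

resolves : State → Column → Bool
resolves (_ , l₀ , l₁ , l₂) (c₀ , c₁ , c₂) =
  (l₀ ⇒ᵇ occupied c₀) ∧ (l₁ ⇒ᵇ occupied c₁) ∧ (l₂ ⇒ᵇ occupied c₂)

potential : State → ℕ
potential ((c0 , c0 , c0) , false , false , false) = 11
potential ((c0 , c0 , c1) , false , false , false) = 8
potential ((c0 , c0 , c1) , false , false , true) = 5
potential ((c0 , c0 , c2) , false , false , false) = 11
potential ((c0 , c0 , c2) , false , false , true) = 8
potential ((c0 , c0 , c3) , false , false , false) = 14
potential ((c0 , c0 , c3) , false , false , true) = 11
potential ((c0 , c1 , c0) , false , false , false) = 5
potential ((c0 , c1 , c0) , false , true , false) = 2
potential ((c0 , c1 , c1) , false , false , false) = 2
potential ((c0 , c1 , c2) , false , false , false) = 5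
potential ((c0 , c1 , c3) , false , false , false) = 8
potential ((c0 , c2 , c0) , false , false , false) = 5
potential ((c0 , c2 , c0) , false , true , false) = 2
potential ((c0 , c2 , c1) , false , false , false) = 5
potential ((c0 , c2 , c2) , false , false , false) = 8
potential ((c0 , c2 , c3) , false , false , false) = 11
potential ((c0 , c3 , c0) , false , false , false) = 8
potential ((c0 , c3 , c0) , false , true , false) = 5
potential ((c0 , c3 , c1) , false , false , false) = 8
potential ((c0 , c3 , c2) , false , false , false) = 11
potential ((c0 , c3 , c3) , false , false , false) = 14
potential ((c1 , c0 , c0) , false , false , false) = 5
potential ((c1 , c0 , c0) , true , false , false) = 6
potential ((c1 , c0 , c1) , false , false , false) = 2
potential ((c1 , c0 , c1) , false , false , true) = 0
potential ((c1 , c0 , c1) , true , false , false) = 3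
potential ((c1 , c0 , c1) , true , false , true) = 3
potential ((c1 , c0 , c2) , false , false , false) = 5
potential ((c1 , c0 , c2) , false , false , true) = 3
potential ((c1 , c0 , c2) , true , false , false) = 6
potential ((c1 , c0 , c2) , true , false , true) = 6
potential ((c1 , c0 , c3) , false , false , false) = 8
potential ((c1 , c0 , c3) , false , false , true) = 6
potential ((c1 , c0 , c3) , true , false , false) = 9
potential ((c1 , c0 , c3) , true , false , true) = 9
potential ((c1 , c1 , c0) , false , false , false) = 2
potential ((c1 , c1 , c1) , false , false , false) = 1
potential ((c1 , c1 , c2) , false , false , false) = 4
potential ((c1 , c1 , c3) , false , false , false) = 7
potential ((c1 , c2 , c0) , false , false , false) = 2
potential ((c1 , c2 , c1) , false , false , false) = 4
potential ((c1 , c2 , c2) , false , false , false) = 7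
potential ((c1 , c2 , c3) , false , false , false) = 10
potential ((c1 , c3 , c0) , false , false , false) = 4
potential ((c1 , c3 , c1) , false , false , false) = 7
potential ((c1 , c3 , c2) , false , false , false) = 10
potential ((c1 , c3 , c3) , false , false , false) = 13
potential ((c2 , c0 , c0) , false , false , false) = 5
potential ((c2 , c0 , c0) , true , false , false) = 6
potential ((c2 , c0 , c1) , false , false , false) = 2
potential ((c2 , c0 , c1) , false , false , true) = 3
potential ((c2 , c0 , c1) , true , false , false) = 3
potential ((c2 , c0 , c1) , true , false , true) = 6
potential ((c2 , c0 , c2) , false , false , false) = 5
potential ((c2 , c0 , c2) , false , false , true) = 6
potential ((c2 , c0 , c2) , true , false , false) = 6
potential ((c2 , c0 , c2) , true , false , true) = 9
potential ((c2 , c0 , c3) , false , false , false) = 8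
potential ((c2 , c0 , c3) , false , false , true) = 9
potential ((c2 , c0 , c3) , true , false , false) = 9
potential ((c2 , c0 , c3) , true , false , true) = 12
potential ((c2 , c1 , c0) , false , false , false) = 5
potential ((c2 , c1 , c1) , false , false , false) = 4
potential ((c2 , c1 , c2) , false , false , false) = 7
potential ((c2 , c1 , c3) , false , false , false) = 10
potential ((c2 , c2 , c0) , false , false , false) = 5
potential ((c2 , c2 , c1) , false , false , false) = 7
potential ((c2 , c2 , c2) , false , false , false) = 10
potential ((c2 , c2 , c3) , false , false , false) = 13
potential ((c2 , c3 , c0) , false , false , false) = 7
potential ((c2 , c3 , c1) , false , false , false) = 10
potential ((c2 , c3 , c2) , false , false , false) = 13
potential ((c2 , c3 , c3) , false , false , false) = 16
potential ((c3 , c0 , c0) , false , false , false) = 8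
potential ((c3 , c0 , c0) , true , false , false) = 9
potential ((c3 , c0 , c1) , false , false , false) = 4
potential ((c3 , c0 , c1) , false , false , true) = 6
potential ((c3 , c0 , c1) , true , false , false) = 6
potential ((c3 , c0 , c1) , true , false , true) = 4
potential ((c3 , c0 , c2) , false , false , false) = 7
potential ((c3 , c0 , c2) , false , false , true) = 9
potential ((c3 , c0 , c2) , true , false , false) = 9
potential ((c3 , c0 , c2) , true , false , true) = 7
potential ((c3 , c0 , c3) , false , false , false) = 10
potential ((c3 , c0 , c3) , false , false , true) = 12
potential ((c3 , c0 , c3) , true , false , false) = 12
potential ((c3 , c0 , c3) , true , false , true) = 10
potential ((c3 , c1 , c0) , false , false , false) = 8
potential ((c3 , c1 , c1) , false , false , false) = 7
potential ((c3 , c1 , c2) , false , false , false) = 10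
potential ((c3 , c1 , c3) , false , false , false) = 13
potential ((c3 , c2 , c0) , false , false , false) = 8
potential ((c3 , c2 , c1) , false , false , false) = 10
potential ((c3 , c2 , c2) , false , false , false) = 13
potential ((c3 , c2 , c3) , false , false , false) = 16
potential ((c3 , c3 , c0) , false , false , false) = 10
potential ((c3 , c3 , c1) , false , false , false) = 13
potential ((c3 , c3 , c2) , false , false , false) = 16
potential ((c3 , c3 , c3) , false , false , false) = 19
-- The states listed are exactly those of the form advance p c; the others only need a value
-- large enough for the checks below.
potential _ = 30

potential-start : ∀ c → T (romanStep emptyColumn c) →
                  8 + potential (advance emptyColumn c) ≤ 3 * columnWeight c
potential-start c = ≤ᵇ⇒≤ _ _ ∘ T-⇒ᵇ (by-evaluation check c)
  where
  check : Column → Bool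
  check c = romanStep emptyColumn c ⇒ᵇ (8 + potential (advance emptyColumn c) ≤ᵇ 3 * columnWeight c)

potential-step : ∀ s c → T (resolves s c) → T (romanStep (proj₁ s) c) →
                 8 + potential (advance (proj₁ s) c) ≤ potential s + 3 * columnWeight c
potential-step s c resolved roman = ≤ᵇ⇒≤ _ _ (T-⇒ᵇ (by-evaluation check (s , c)) (T-∧-intro resolved roman))
  where
  check : State × Column → Bool
  check (s , c) = resolves s c ∧ romanStep (proj₁ s) c ⇒ᵇ
                  (8 + potential (advance (proj₁ s) c) ≤ᵇ potential s + 3 * columnWeight c)

potential-end : ∀ s → T (resolves s emptyColumn) → 1 ≤ potential s
potential-end s = ≤ᵇ⇒≤ _ _ ∘ T-⇒ᵇ (by-evaluation check s)
  where
  check : State → Bool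
  check s = resolves s emptyColumn ⇒ᵇ (1 ≤ᵇ potential s)

record AdmissibleProfile (n : ℕ) (X : ℕ → Column) : Set where
  field
    starts-empty : X 0 ≡ emptyColumn
    ends-empty   : X (suc n) ≡ emptyColumn
    roman        : ∀ j → j < n → T (romanStep (X j) (X (suc j)))
    total        : ∀ j → j < n → T (resolves (advance (X j) (X (suc j))) (X (suc (suc j))))

telescope-step : ∀ {d a b p q c} → a + p ≤ b → d + q ≤ p + c → d + a + q ≤ b + c
telescope-step {d} {a} {b} {p} {q} {c} a+p≤b d+q≤p+c = begin
  d + a + q   ≡⟨ cong (_+ q) (+-comm d a) ⟩
  a + d + q   ≡⟨ +-assoc a d q ⟩
  a + (d + q) ≤⟨ +-monoʳ-≤ a d+q≤p+c ⟩
  a + (p + c) ≡⟨ +-assoc a p c ⟨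
  a + p + c   ≤⟨ +-monoˡ-≤ c a+p≤b ⟩
  b + c       ∎
  where open ≤-Reasoning

module _ {n X} (A : AdmissibleProfile n X) where
  open AdmissibleProfile A

  potential-invariant : ∀ j → j < n →
    8 * suc j + potential (advance (X j) (X (suc j))) ≤ 3 * sumTo (suc j) (columnWeight ∘ X ∘ suc)
  potential-invariant zero 0<n =
    subst (λ x → 8 + potential (advance x (X 1)) ≤ 3 * columnWeight (X 1)) (sym starts-empty)
      (potential-start (X 1) (subst (λ x → T (romanStep x (X 1))) starts-empty (roman 0 0<n)))
  potential-invariant (suc j) j+1<n = begin
    8 * suc (suc j) + Φ′                         ≡⟨ cong (_+ Φ′) (*-suc 8 (suc j)) ⟩
    8 + 8 * suc j + Φ′                           ≤⟨ telescope-step {8} {p = Φ} {Φ′} (potential-invariant j j<n)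
                                                      (potential-step (advance (X j) (X (suc j))) (X (suc (suc j)))
                                                        (total j j<n) (roman (suc j) j+1<n)) ⟩
    3 * W + 3 * columnWeight (X (suc (suc j)))   ≡⟨ *-distribˡ-+ 3 W _ ⟨
    3 * sumTo (suc (suc j)) (columnWeight ∘ X ∘ suc) ∎
    where
    open ≤-Reasoning
    j<n : j < n
    j<n = <-trans (n<1+n j) j+1<n
    Φ Φ′ W : ℕ
    Φ  = potential (advance (X j) (X (suc j)))
    Φ′ = potential (advance (X (suc j)) (X (suc (suc j))))
    W  = sumTo (suc j) (columnWeight ∘ X ∘ suc)

profile-bound : ∀ {k X} → AdmissibleProfile (suc k) X →
                8 * suc k < 3 * sumTo (suc k) (columnWeight ∘ X ∘ suc)
profile-bound {k} {X} A = begin-strict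
  8 * suc k                                         <⟨ m<m+n (8 * suc k) (potential-end _ last-resolved) ⟩
  8 * suc k + potential (advance (X k) (X (suc k))) ≤⟨ potential-invariant A k ≤-refl ⟩
  3 * sumTo (suc k) (columnWeight ∘ X ∘ suc)        ∎
  where
  open ≤-Reasoning
  open AdmissibleProfile A
  last-resolved : T (resolves (advance (X k) (X (suc k))) emptyColumn)
  last-resolved = subst (T ∘ resolves (advance (X k) (X (suc k)))) ends-empty (total k ≤-refl)

module _ {n} (g : Grid 3 n 3) where

  profile : ℕ → Column
  profile j = toCard ∣ pad g 1 j ∣ , toCard ∣ pad g 2 j ∣ , toCard ∣ pad g 3 j ∣

  private
    self : Fin 3 → Fin n → Subset 3
    self r J = pad g (suc (toℕ r)) (suc (toℕ J))

  dominated-cell : LocallyRoman g → ∀ r J →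
    T (dominated (toCard ∣ self r J ∣) (toCard ∣ up g r J ∣) (toCard ∣ left g r J ∣))
  dominated-cell roman r J rewrite pad-cell g r J with ∣ g r J ∣ in ∣gJ∣≡
  ... | suc a = Equivalence.from T-∨ (inj₁ (occupied-toCard-suc a))
  ... | zero  = ≤⇒≤ᵇ (fromCard-toCard-+ ∣ up g r J ∣ ∣ left g r J ∣
                  (covering-size (up g r J) (left g r J) (roman r J (∣p∣≡0⇒p≡⊥ (g r J) ∣gJ∣≡))))

  resolved-cell : LocallyTotal g → ∀ r J →
    T (isolated (toCard ∣ self r J ∣) (toCard ∣ up g r J ∣) (toCard ∣ left g r J ∣) (toCard ∣ down g r J ∣)
         ⇒ᵇ occupied (toCard ∣ right g r J ∣))
  resolved-cell total r J rewrite pad-cell g r J with ∣ g r J ∣ in ∣gJ∣≡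
  ... | zero  = _
  ... | suc a = isolated-resolved _ _ _ _ _
                  (Sum.map (Sum.map (occupied-toCard _) (occupied-toCard _))
                           (Sum.map (occupied-toCard _) (occupied-toCard _)) (total r J gJ≢∅))
    where
    gJ≢∅ : g r J ≢ ∅
    gJ≢∅ gJ≡∅ = contradiction (trans (sym ∣gJ∣≡) (trans (cong ∣_∣ gJ≡∅) (∣⊥∣≡0 3))) λ ()

  profile-admissible : LocallyRoman g → LocallyTotal g → AdmissibleProfile n profile
  profile-admissible roman total = record
    { starts-empty = refl
    ; ends-empty   = cong₂ _,_ (empty-at 1) (cong₂ _,_ (empty-at 2) (empty-at 3))
    ; roman        = λ j j<n → subst (λ j → T (romanStep (profile j) (profile (suc j)))) (toℕ-fromℕ< j<n)
                       (let J = fromℕ< j<n in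
                        T-∧-intro (dominated-cell roman 0F J)
                          (T-∧-intro (dominated-cell roman 1F J) (dominated-cell roman 2F J)))
    ; total        = λ j j<n → subst (λ j → T (resolves (advance (profile j) (profile (suc j))) (profile (suc (suc j)))))
                       (toℕ-fromℕ< j<n)
                       (let J = fromℕ< j<n in
                        T-∧-intro (resolved-cell total 0F J)
                          (T-∧-intro (resolved-cell total 1F J) (resolved-cell total 2F J)))
    }
    where
    empty-at : ∀ i → toCard ∣ pad g i (suc n) ∣ ≡ c0
    empty-at i = cong (toCard ∘ ∣_∣) (pad-beyond g i)

  column-weight≤ : ∀ J → columnWeight (profile (suc (toℕ J))) ≤ sum {3} (λ r → ∣ g r J ∣)
  column-weight≤ J rewrite pad-cell g 0F J | pad-cell g 1F J | pad-cell g 2F J =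
    +-mono-≤ (fromCard-toCard≤ ∣ g 0F J ∣)
      (+-mono-≤ (fromCard-toCard≤ ∣ g 1F J ∣) (≤-trans (fromCard-toCard≤ ∣ g 2F J ∣) (m≤m+n ∣ g 2F J ∣ 0)))

lower-bound : ∀ {m} {f : Fin (3 * suc m) → Subset 3} → IsTKRDF (P 3 □ P (suc m)) 3 f →
              8 * suc m < 3 * weight (P 3 □ P (suc m)) f
lower-bound {m} {f} tkrdf = begin-strict
  8 * suc m                                           <⟨ profile-bound (profile-admissible g roman total) ⟩
  3 * sumTo (suc m) (columnWeight ∘ profile g ∘ suc)  ≡⟨ cong (3 *_) (sum-toℕ (suc m) _) ⟨
  3 * sum {suc m} (columnWeight ∘ profile g ∘ suc ∘ toℕ) ≤⟨ *-monoʳ-≤ 3 (sum-mono-≤ (column-weight≤ g)) ⟩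
  3 * sum {suc m} (λ J → sum {3} (λ r → ∣ g r J ∣))     ≡⟨ cong (3 *_) (weight-□ (P 3) (P (suc m)) f) ⟨
  3 * weight (P 3 □ P (suc m)) f                      ∎
  where
  open ≤-Reasoning
  g : Grid 3 (suc m) 3
  g = cellsOf f
  roman : LocallyRoman g
  roman = proj₁ (IsTKRDF⇒local tkrdf)
  total : LocallyTotal g
  total = proj₂ (IsTKRDF⇒local tkrdf)

data Phase : Set where
  ph₀ ph₁ ph₂ : Phase

phase : ℕ → Phase
phase 0 = ph₀
phase 1 = ph₁
phase 2 = ph₂
phase (suc (suc (suc j))) = phase j

next : Phase → Phase
next ph₀ = ph₁
next ph₁ = ph₂
next ph₂ = ph₀

phase-suc : ∀ j → phase (suc j) ≡ next (phase j)
phase-suc 0 = refl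
phase-suc 1 = refl
phase-suc 2 = refl
phase-suc (suc (suc (suc j))) = phase-suc j

α : Subset 3
α = ⁅ 0F ⁆

α-or-∁α : ∀ c → c ∈ α ⊎ c ∈ ∁ α
α-or-∁α 0F = inj₁ here
α-or-∁α 1F = inj₂ (there here)
α-or-∁α 2F = inj₂ (there (there here))

stripe : Fin 3 → Phase → Bool → Subset 3
stripe 0F _   _     = α
stripe 1F ph₀ _     = α
stripe 1F ph₁ _     = ∁ α
stripe 1F ph₂ false = ∅
stripe 1F ph₂ true  = α   -- a final column: otherwise its bottom cell would be isolated
stripe 2F ph₁ _     = ∅
stripe 2F _   _     = α

last? : ℕ → ℕ → Bool
last? n j = suc j ≡ᵇ n

design : ∀ n → Grid 3 n 3
design n r J = stripe r (phase (toℕ J)) (last? n (toℕ J))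

≡α⇒≢∅ : ∀ {S} → S ≡ α → S ≢ ∅
≡α⇒≢∅ refl ()

design-left : ∀ {n} r (b : Fin n) → left (design (suc n)) r (Fin.suc b) ≡ stripe r (phase (toℕ b)) false
design-left {n} r b = begin
  left (design (suc n)) r (Fin.suc b)
    ≡⟨ left-suc (design (suc n)) r b ⟩
  stripe r (phase (toℕ (inject₁ b))) (last? (suc n) (toℕ (inject₁ b)))
    ≡⟨ cong (λ j → stripe r (phase j) (last? (suc n) j)) (toℕ-inject₁ b) ⟩
  stripe r (phase (toℕ b)) (toℕ b ≡ᵇ n)
    ≡⟨ cong (stripe r (phase (toℕ b))) (<⇒≡ᵇ-false (toℕ<n b)) ⟩
  stripe r (phase (toℕ b)) false
    ∎
  where open ≡-Reasoning

middle-empty : ∀ p x → stripe 1F (next p) x ≡ ∅ → p ≡ ph₁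
middle-empty ph₁ false _ = refl
middle-empty ph₁ true  ()
middle-empty ph₀ _     ()
middle-empty ph₂ _     ()

bottom-empty : ∀ p x → stripe 2F (next p) x ≡ ∅ → p ≡ ph₀
bottom-empty ph₀ _ _  = refl
bottom-empty ph₁ _ ()
bottom-empty ph₂ _ ()

bottom-supported : ∀ p x → stripe 2F p x ≢ ∅ → stripe 1F p x ≡ α ⊎ (p ≡ ph₂ × x ≡ false)
bottom-supported ph₀ _     _  = inj₁ refl
bottom-supported ph₁ _     ≢∅ = contradiction refl ≢∅
bottom-supported ph₂ true  _  = inj₁ refl
bottom-supported ph₂ false _  = inj₂ (refl , refl)

design-roman : ∀ n → LocallyRoman (design n)
design-roman _       0F J           ()
design-roman _       1F 0F          ()
design-roman _       2F 0F          ()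
design-roman (suc n) 1F (Fin.suc b) g≡∅ c =
  Sum.map (subst (c ∈_) (sym (pad-cell (design (suc n)) 0F (Fin.suc b))))
          (subst (c ∈_) (sym (trans (design-left 1F b) (cong (λ p → stripe 1F p false) previous-ph₁))))
          (α-or-∁α c)
  where
  previous-ph₁ : phase (toℕ b) ≡ ph₁
  previous-ph₁ = middle-empty (phase (toℕ b)) _
    (subst (λ p → stripe 1F p (last? (suc n) (suc (toℕ b))) ≡ ∅) (phase-suc (toℕ b)) g≡∅)
design-roman (suc n) 2F (Fin.suc b) g≡∅ c =
  Sum.map (subst (c ∈_) (sym (trans (pad-cell (design (suc n)) 1F (Fin.suc b))
                                    (cong (λ p → stripe 1F p (last? (suc n) (suc (toℕ b)))) phase-ph₁))))
          (subst (c ∈_) (sym (trans (design-left 2F b) (cong (λ p → stripe 2F p false) previous-ph₀))))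
          (Sum.swap (α-or-∁α c))
  where
  previous-ph₀ : phase (toℕ b) ≡ ph₀
  previous-ph₀ = bottom-empty (phase (toℕ b)) _
    (subst (λ p → stripe 2F p (last? (suc n) (suc (toℕ b))) ≡ ∅) (phase-suc (toℕ b)) g≡∅)
  phase-ph₁ : phase (suc (toℕ b)) ≡ ph₁
  phase-ph₁ = trans (phase-suc (toℕ b)) (cong next previous-ph₀)

design-total : ∀ n → LocallyTotal (design n)
design-total (suc n) 0F 0F          _ = inj₂ (inj₁ (≡α⇒≢∅ (pad-cell (design (suc n)) 1F 0F)))
design-total (suc n) 0F (Fin.suc b) _ = inj₁ (inj₂ (≡α⇒≢∅ (design-left 0F b)))
design-total n       1F J           _ = inj₁ (inj₁ (≡α⇒≢∅ (pad-cell (design n) 0F J)))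
design-total n       2F J           labelled with bottom-supported (phase (toℕ J)) (last? n (toℕ J)) labelled
... | inj₁ middle≡α = inj₁ (inj₁ (≡α⇒≢∅ (trans (pad-cell (design n) 1F J) middle≡α)))
... | inj₂ (phase≡ph₂ , not-last) =
  inj₂ (inj₂ (≡α⇒≢∅ (trans (right-next (design n) 2F J J+1<n)
                              (cong (λ p → stripe 2F p (last? n (toℕ (fromℕ< J+1<n)))) next-ph₀))))
  where
  J+1<n : suc (toℕ J) < n
  J+1<n = ≤∧≢⇒< (toℕ<n J) (≡ᵇ-false⇒≢ not-last)
  next-ph₀ : phase (toℕ (fromℕ< J+1<n)) ≡ ph₀
  next-ph₀ = trans (cong phase (toℕ-fromℕ< J+1<n)) (trans (phase-suc (toℕ J)) (cong next phase≡ph₂))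

columnSize : Phase → Bool → ℕ
columnSize p x = sum {3} (λ r → ∣ stripe r p x ∣)

design-weight : ∀ n →
  weight (P 3 □ P n) (fromCells (design n)) ≡ sumTo n (λ j → columnSize (phase j) (last? n j))
design-weight n = begin
  weight (P 3 □ P n) (fromCells (design n))
    ≡⟨ weight-□ (P 3) (P n) (fromCells (design n)) ⟩
  sum {n} (λ J → sum {3} (λ r → ∣ fromCells (design n) (combine r J) ∣))
    ≡⟨ sum-cong-≗ {n} (λ J → sum-cong-≗ {3} (λ r → cong ∣_∣ (fromCells-combine (design n) r J))) ⟩
  sum {n} (λ J → sum {3} (λ r → ∣ design n r J ∣))
    ≡⟨ sum-toℕ n (λ j → columnSize (phase j) (last? n j)) ⟩
  sumTo n (λ j → columnSize (phase j) (last? n j))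
    ∎
  where open ≡-Reasoning

excess : Phase → ℕ
excess ph₀ = 0
excess ph₁ = 1
excess ph₂ = 2

excess-step : ∀ p → excess p + 3 * columnSize p false ≡ 8 + excess (next p)
excess-step ph₀ = refl
excess-step ph₁ = refl
excess-step ph₂ = refl

excess-last : ∀ p → excess p + 3 * columnSize p true ≤ 8 + 3
excess-last ph₀ = ≤ᵇ⇒≤ 9 11 _
excess-last ph₁ = ≤ᵇ⇒≤ 10 11 _
excess-last ph₂ = ≤-refl

8*[1+m]+e : ∀ m e → 8 * m + (8 + e) ≡ 8 * suc m + e
8*[1+m]+e m e = begin
  8 * m + (8 + e) ≡⟨ +-assoc (8 * m) 8 e ⟨
  8 * m + 8 + e   ≡⟨ cong (_+ e) (+-comm (8 * m) 8) ⟩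
  8 + 8 * m + e   ≡⟨ cong (_+ e) (*-suc 8 m) ⟨
  8 * suc m + e   ∎
  where open ≡-Reasoning

interior-weight : ∀ m → 3 * sumTo m (λ j → columnSize (phase j) false) ≡ 8 * m + excess (phase m)
interior-weight zero    = refl
interior-weight (suc m) = begin
  3 * (S + c)                          ≡⟨ *-distribˡ-+ 3 S c ⟩
  3 * S + 3 * c                        ≡⟨ cong (_+ 3 * c) (interior-weight m) ⟩
  8 * m + excess (phase m) + 3 * c     ≡⟨ +-assoc (8 * m) _ _ ⟩
  8 * m + (excess (phase m) + 3 * c)   ≡⟨ cong (8 * m +_) (excess-step (phase m)) ⟩
  8 * m + (8 + excess (next (phase m))) ≡⟨ 8*[1+m]+e m _ ⟩
  8 * suc m + excess (next (phase m))  ≡⟨ cong (λ p → 8 * suc m + excess p) (phase-suc m) ⟨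
  8 * suc m + excess (phase (suc m))   ∎
  where
  open ≡-Reasoning
  S c : ℕ
  S = sumTo m (λ j → columnSize (phase j) false)
  c = columnSize (phase m) false

design-weight≤ : ∀ m → 3 * weight (P 3 □ P (suc m)) (fromCells (design (suc m))) ≤ 8 * suc m + 3
design-weight≤ m = begin
  3 * weight (P 3 □ P (suc m)) (fromCells (design (suc m)))
    ≡⟨ cong (3 *_) (design-weight (suc m)) ⟩
  3 * (sumTo m (λ j → columnSize (phase j) (j ≡ᵇ m)) + columnSize (phase m) (m ≡ᵇ m))
    ≡⟨ cong₂ (λ s x → 3 * (s + columnSize (phase m) x))
         (sumTo-cong< m (λ j j<m → cong (columnSize (phase j)) (<⇒≡ᵇ-false j<m)))
         (Equivalence.to T-≡ (≡⇒≡ᵇ m m refl)) ⟩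
  3 * (S + c)                           ≡⟨ *-distribˡ-+ 3 S c ⟩
  3 * S + 3 * c                         ≡⟨ cong (_+ 3 * c) (interior-weight m) ⟩
  8 * m + excess (phase m) + 3 * c      ≡⟨ +-assoc (8 * m) _ _ ⟩
  8 * m + (excess (phase m) + 3 * c)    ≤⟨ +-monoʳ-≤ (8 * m) (excess-last (phase m)) ⟩
  8 * m + (8 + 3)                       ≡⟨ 8*[1+m]+e m 3 ⟩
  8 * suc m + 3                         ∎
  where
  open ≤-Reasoning
  S c : ℕ
  S = sumTo m (λ j → columnSize (phase j) false)
  c = columnSize (phase m) true

P3□P-γtr3 : ∀ m → IsTotalKRomanDomNumber (P 3 □ P (suc m)) 3 (suc (8 * suc m / 3))
P3□P-γtr3 m = (fromCells (design n) , design-tkrdf , weight≡) , ⌊8n/3⌋<weight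
  where
  n : ℕ
  n = suc m

  design-tkrdf : IsTKRDF (P 3 □ P n) 3 (fromCells (design n))
  design-tkrdf = local⇒IsTKRDF (design-roman n) (design-total n)

  ⌊8n/3⌋<weight : ∀ f → IsTKRDF (P 3 □ P n) 3 f → suc (8 * n / 3) ≤ weight (P 3 □ P n) f
  ⌊8n/3⌋<weight f tkrdf =
    m<n*o⇒m/o<n (subst (8 * n <_) (*-comm 3 (weight (P 3 □ P n) f)) (lower-bound tkrdf))

  weight≡ : weight (P 3 □ P n) (fromCells (design n)) ≡ suc (8 * n / 3)
  weight≡ = ≤-antisym (≤suc[/] {8 * n} 3 (design-weight≤ m)) (⌊8n/3⌋<weight _ design-tkrdf)

ceil3[8n] : ∀ n → ceil3 (8 * n) ≡ ((2 * (n % 3)) % 3 + 2) / 3 + 8 * n / 3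
ceil3[8n] n = begin
  (a + 2) / 3                         ≡⟨ cong (λ x → (x + 2) / 3) (m≡m%n+[m/n]*n a 3) ⟩
  (a % 3 + q * 3 + 2) / 3             ≡⟨ cong (_/ 3) (+-assoc (a % 3) (q * 3) 2) ⟩
  (a % 3 + (q * 3 + 2)) / 3           ≡⟨ cong (λ x → (a % 3 + x) / 3) (+-comm (q * 3) 2) ⟩
  (a % 3 + (2 + q * 3)) / 3           ≡⟨ cong (_/ 3) (+-assoc (a % 3) 2 (q * 3)) ⟨
  (a % 3 + 2 + q * 3) / 3             ≡⟨ +-distrib-/-∣ʳ (a % 3 + 2) (divides-refl q) ⟩
  (a % 3 + 2) / 3 + q * 3 / 3         ≡⟨ cong₂ (λ r x → (r + 2) / 3 + x) (%-distribˡ-* 8 n 3) (m*n/n≡m q 3) ⟩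
  ((2 * (n % 3)) % 3 + 2) / 3 + q     ∎
  where
  open ≡-Reasoning
  a q : ℕ
  a = 8 * n
  q = a / 3

proposition4p3 : ∀ (n : ℕ) → 3 ≤ n →
    (n % 3 ≡ 0 → IsTotalKRomanDomNumber (P 3 □ P n) 3 (ceil3 (8 * n) + 1)) ×
    (n % 3 ≡ 1 → IsTotalKRomanDomNumber (P 3 □ P n) 3 (ceil3 (8 * n))) ×
    (n % 3 ≡ 2 → IsTotalKRomanDomNumber (P 3 □ P n) 3 (ceil3 (8 * n)))
proposition4p3 zero ()
proposition4p3 n@(suc m) _ =
    (λ n%3≡0 → subst γtr3 (trans (+-comm 1 (8 * n / 3)) (cong (_+ 1) (sym (residue n%3≡0)))) (P3□P-γtr3 m))
  , (λ n%3≡1 → subst γtr3 (sym (residue n%3≡1)) (P3□P-γtr3 m))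
  , (λ n%3≡2 → subst γtr3 (sym (residue n%3≡2)) (P3□P-γtr3 m))
  where
  γtr3 : ℕ → Set
  γtr3 = IsTotalKRomanDomNumber (P 3 □ P n) 3

  residue : ∀ {r} → n % 3 ≡ r → ceil3 (8 * n) ≡ ((2 * r) % 3 + 2) / 3 + 8 * n / 3
  residue refl = ceil3[8n] n
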